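{- Let $n \ge 2$ be an integer and $T$ a rooted tree with $n$ nodes. Let $\varepsilon > 0$ be the unique real number with $\lg(1+\varepsilon) = \lceil \lg n \rceil^{ -1}$, and let $S = \{ \lfloor (1+\varepsilon)^k \rfloor : k \in \{0,1,\dots,4\lceil \lg n\rceil^2 - 1\} \}$. For a node $u$ let $T_u$ denote the set of descendants of $u$ (including $u$). Consider the recursive procedure $\mathrm{AssignNew}(u,t)$ (for a node $u$ and an integer $t$) which does the following: (1) set $a(u), \overline{a}(u), b(u), \overline{b}(u)$ all equal to $t$; (2) let $v_1,\dots,v_k$ be the children of $u$ ordered so that $|T_{v_1}| \le \dots \le |T_{v_k}|$; for $i = 1,\dots,k$ in this order, call $\mathrm{AssignNew}(v_i, \overline{b}(u)+1)$ (using the current value of $\overline{b}(u)$) and then set $\overline{a}(u) \gets \overline{a}(v_i)$ and $\overline{b}(u) \gets \overline{b}(v_i)$; (3) set $b(u)$ to the smallest integer such that $b(u) \ge \overline{a}(u)$ (current value) and $b(u) - a(u) + 1 \in S$; (4) set $\overline{b}(u) \gets \max\{b(u), \overline{b}(u)\}$. Then for every node $u$ of $T$ and every integer $t$, after the call $\mathrm{AssignNew}(u,t)$ terminates, \[ \overline{a}(u) - a(u) + 1 \le |T_u| (1+\varepsilon)^{\lfloor \lg |T_u| \rfloor}, \qquad \overline{b}(u) - a(u) + 1 \le |T_u| (1+\varepsilon)^{\lfloor \lg |T_u| \rfloor + 1}. \]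
   Context: $\lg$ denotes the base-$2$ logarithm. In a rooted tree, $v$ is a descendant of $u$ if $u$ lies on the unique path from the root to $v$; every node is a descendant of itself. -}

module Defs where

open import Data.Nat as ℕ using (ℕ; zero; suc; _^_)
open import Data.Nat.Logarithm using (⌈log₂_⌉; ⌊log₂_⌋)
open import Data.Integer as ℤ using (ℤ; +_; _-_; _⊔_)
open import Data.List using (List; []; _∷_)
open import Data.List.Relation.Unary.All using (All)
open import Data.List.Relation.Unary.Linked using (Linked)
open import Data.List.Membership.Propositional using (_∈_)
open import Data.Product using (Σ; _×_; ∃)
open import Data.Sum using (_⊎_)
open import Relation.Binary.PropositionalEquality using (_≡_)

data Tree : Set where
  node : List Tree → Tree

size  : Tree → ℕ
sizes : List Tree → ℕ
size (node ts) = suc (sizes ts)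
sizes []       = 0
sizes (t ∷ ts) = size t ℕ.+ sizes ts

-- At every node the children are listed so that |T_{v1}| ≤ … ≤ |T_{vk}|
-- (any tie-breaking is allowed: the tree's list order is the chosen one).
data Ordered : Tree → Set where
  ord : ∀ {ts} → Linked (λ x y → size x ℕ.≤ size y) ts → All Ordered ts → Ordered (node ts)

data _≼_ : Tree → Tree → Set where
  here  : ∀ {u} → u ≼ u
  there : ∀ {u c ts} → u ≼ c → c ∈ ts → u ≼ node ts

-- With L = ⌈lg n⌉ we have 1+ε = 2^(1/L), so ⌊(1+ε)^k⌋ = ⌊2^(k/L)⌋, which is the
-- unique natural m with m^L ≤ 2^k < (m+1)^L  (L ≥ 1).
IsFloorPow : (L k m : ℕ) → Set
IsFloorPow L k m = (m ^ L ℕ.≤ 2 ^ k) × (2 ^ k ℕ.< suc m ^ L)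

InS : (L m : ℕ) → Set
InS L m = Σ ℕ λ k → (k ℕ.< 4 ℕ.* L ℕ.* L) × IsFloorPow L k m

InSℤ : (L : ℕ) → ℤ → Set
InSℤ L z = Σ ℕ λ m → (z ≡ + m) × InS L m

-- x ≤ s · (1+ε)^j  =  s · 2^(j/L)   (real inequality, stated exactly in integers:
-- either x ≤ 0, or x = m > 0 and m^L ≤ s^L · 2^j)
LeScaled : (L : ℕ) → ℤ → (s j : ℕ) → Set
LeScaled L x s j = (x ℤ.≤ + 0) ⊎ (Σ ℕ λ m → (x ≡ + m) × (m ^ L ℕ.≤ s ^ L ℕ.* 2 ^ j))

record Vals : Set where
  constructor vals
  field
    a abar b bbar : ℤ
open Vals public

IsLeastB : (L : ℕ) (a abar b : ℤ) → Set
IsLeastB L a abar b =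
  (abar ℤ.≤ b) × InSℤ L (b - a ℤ.+ + 1) ×
  (∀ c → abar ℤ.≤ c → InSℤ L (c - a ℤ.+ + 1) → b ℤ.≤ c)

-- Big-step semantics of AssignNew(u, t) (parameterised by L = ⌈lg n⌉):
-- Run L u t r  :  the call AssignNew(u,t) terminates with final values r.
-- RunKids L cs ā b̄ ā' b̄' : processing children cs in order, starting from
-- current (ā(u), b̄(u)) = (ā, b̄), ends with (ā', b̄').
data Run (L : ℕ) : Tree → ℤ → Vals → Set
data RunKids (L : ℕ) : List Tree → (abar bbar abar' bbar' : ℤ) → Set

data Run L where
  run : ∀ {ts t abar' bbar' b} →
        RunKids L ts t t abar' bbar' →
        IsLeastB L t abar' b →
        Run L (node ts) t (vals t abar' b (b ⊔ bbar'))

data RunKids L where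
  done : ∀ {abar bbar} → RunKids L [] abar bbar abar bbar
  step : ∀ {c cs abar bbar abar' bbar'} {r : Vals} →
         Run L c (bbar ℤ.+ + 1) r →
         RunKids L cs (Vals.abar r) (Vals.bbar r) abar' bbar' →
         RunKids L (c ∷ cs) abar bbar abar' bbar'

{-# OPTIONS --safe #-}
-- With 1 + ε = 2^(1/L), L = ⌈lg n⌉, the bound x ≤ s(1+ε)^j means x^L ≤ s^L 2^j. Such bounds
-- add up: if x ≤ s c and y ≤ t c then x + y ≤ (s + t) c, since the mediant (x + y)/(s + t)
-- lies between x/s and y/t. The children
-- v of u come in increasing size, so every child but the last has 2|T_v| ≤ |T_u| and its
-- bound on b̄(v) − a(v) + 1, with exponent ⌊lg|T_v|⌋ + 1, already has exponent at most
-- ⌊lg|T_u|⌋; summing over the children bounds ā(u), and only the last child costs b̄(u) the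
-- extra factor. Finally b(u) − a(u) + 1 is at most ā(u) − a(u) + 1 rounded up into S, and
-- rounding costs one factor 1 + ε: for the least k with x^L ≤ 2^k, the element ⌊2^(k/L)⌋
-- of S is at least x and its L-th power is at most 2^k ≤ 2x^L. Here k ≤ L² + L < 4L²
-- because |T_u| ≤ n ≤ 2^L.
module Submission where

open import Defs
open import Data.Nat using (ℕ; _≤_; _+_)
open import Data.Nat.Logarithm using (⌈log₂_⌉; ⌊log₂_⌋)
open import Data.Integer using (ℤ; +_) renaming (_+_ to _+ℤ_; _-_ to _-ℤ_)
open import Data.Product using (_×_)
open import Relation.Binary.PropositionalEquality using (_≡_)

open import Data.Nat
  using (zero; suc; _*_; _^_; _<_; _≰_; z≤n; s≤s; z<s; NonZero; >-nonZero; >-nonZero⁻¹; ⌊_/2⌋; ⌈_/2⌉)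
open import Data.Nat.Properties
open import Data.Nat.Logarithm
  using (⌊log₂⌋-mono-≤; ⌈log₂⌉-mono-≤; ⌊log₂[2^n]⌋≡n; ⌊log₂[2*b]⌋≡1+⌊log₂b⌋; ⌈log₂2^n⌉≡n)
open import Data.Nat.Logarithm.Core using (⌈log2⌉)
open import Data.Nat.Induction using (<-wellFounded)
import Data.Nat.Tactic.RingSolver as ℕ-Ring
open import Data.Integer as ℤ using (1ℤ; _⊔_)
import Data.Integer.Properties as ℤ
import Data.Integer.Tactic.RingSolver as ℤ-Ring
open import Data.List using (_∷_)
open import Data.List.Relation.Unary.All as All using (All; _∷_)
open import Data.List.Relation.Unary.Linked using (Linked; _∷_)
open import Data.List.Membership.Propositional using (_∈_)
open import Data.List.Relation.Unary.Any using (here; there)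
open import Data.Product using (Σ; _,_)
open import Data.Sum using (inj₂; [_,_]′)
open import Induction.WellFounded using (Acc; acc)
open import Relation.Nullary using (yes; no)
open import Relation.Binary.PropositionalEquality
  using (refl; sym; trans; cong; cong₂; subst; subst₂; module ≡-Reasoning)

^-distribʳ-* : ∀ m n o → (m * n) ^ o ≡ m ^ o * n ^ o
^-distribʳ-* m n zero    = refl
^-distribʳ-* m n (suc o) =
  trans (cong (m * n *_) (^-distribʳ-* m n o)) ([m*n]*[o*p]≡[m*o]*[n*p] m n (m ^ o) (n ^ o))

^-cancelˡ-< : ∀ n {x y} → x ^ n < y ^ n → x < y
^-cancelˡ-< n x^n<y^n = ≰⇒> (λ y≤x → <⇒≱ x^n<y^n (^-monoˡ-≤ n y≤x))

0^n≡0 : ∀ n .{{_ : NonZero n}} → 0 ^ n ≡ 0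
0^n≡0 (suc n) = refl

n*n+n<4*n*n : ∀ n .{{_ : NonZero n}} → n * n + n < 4 * n * n
n*n+n<4*n*n (suc n) = subst (suc (suc n * suc n + suc n) ≤_) (sym (expand n)) (m≤m+n _ _)
  where
  expand : ∀ n → 4 * suc n * suc n ≡ suc (suc n * suc n + suc n) + (3 * n * n + 5 * n + 1)
  expand = ℕ-Ring.solve-∀

n≤2^⌈log₂n⌉ : ∀ n → n ≤ 2 ^ ⌈log₂ n ⌉
n≤2^⌈log₂n⌉ n = go n (<-wellFounded n)
  where
  n≤2*⌈n/2⌉ : ∀ n → n ≤ 2 * ⌈ n /2⌉
  n≤2*⌈n/2⌉ n = begin
    n                  ≡⟨ sym (⌊n/2⌋+⌈n/2⌉≡n n) ⟩
    ⌊ n /2⌋ + ⌈ n /2⌉  ≤⟨ +-monoˡ-≤ _ (⌊n/2⌋≤⌈n/2⌉ n) ⟩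
    ⌈ n /2⌉ + ⌈ n /2⌉  ≡⟨ cong (λ m → ⌈ n /2⌉ + m) (sym (+-identityʳ _)) ⟩
    2 * ⌈ n /2⌉        ∎
    where open ≤-Reasoning
  go : ∀ n (rec : Acc _<_ n) → n ≤ 2 ^ ⌈log2⌉ n rec
  go 0             _        = z≤n
  go 1             _        = s≤s z≤n
  go (suc (suc n)) (acc rs) =
    ≤-trans (n≤2*⌈n/2⌉ (2 + n)) (*-monoʳ-≤ 2 (go _ (rs (⌈n/2⌉<n n))))

n≤2^k⇒⌈log₂n⌉≤k : ∀ {n k} → n ≤ 2 ^ k → ⌈log₂ n ⌉ ≤ k
n≤2^k⇒⌈log₂n⌉≤k {k = k} n≤2^k = subst (_ ≤_) (⌈log₂2^n⌉≡n k) (⌈log₂⌉-mono-≤ n≤2^k)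

2^⌈log₂n⌉≤2*n : ∀ n .{{_ : NonZero n}} → 2 ^ ⌈log₂ n ⌉ ≤ 2 * n
2^⌈log₂n⌉≤2*n n with ⌈log₂ n ⌉ in eq
... | zero  = ≤-trans (>-nonZero⁻¹ n) (m≤m+n n (n + 0))
... | suc k = *-monoʳ-≤ 2 (<⇒≤ (≰⇒> n≰2^k))
  where
  n≰2^k : n ≰ 2 ^ k
  n≰2^k n≤2^k = 1+n≰n (subst (_≤ k) eq (n≤2^k⇒⌈log₂n⌉≤k {n} n≤2^k))

2*m≤n⇒⌊log₂m⌋+1≤⌊log₂n⌋ : ∀ {m n} .{{_ : NonZero m}} → 2 * m ≤ n → ⌊log₂ m ⌋ + 1 ≤ ⌊log₂ n ⌋
2*m≤n⇒⌊log₂m⌋+1≤⌊log₂n⌋ {m} 2m≤n =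
  subst (_≤ _) (trans (⌊log₂[2*b]⌋≡1+⌊log₂b⌋ m) (+-comm 1 _)) (⌊log₂⌋-mono-≤ 2m≤n)

n≤2^k⇒⌊log₂n⌋≤k : ∀ {n k} → n ≤ 2 ^ k → ⌊log₂ n ⌋ ≤ k
n≤2^k⇒⌊log₂n⌋≤k {k = k} n≤2^k = subst (_ ≤_) (⌊log₂[2^n]⌋≡n k) (⌊log₂⌋-mono-≤ n≤2^k)

width : ℤ → ℤ → ℤ
width t x = x -ℤ t +ℤ + 1

width-self : ∀ t → width t t ≡ + 1
width-self t = cong (_+ℤ + 1) (ℤ.+-inverseʳ t)

-- The ring solver needs `width` unfolded, hence the restated identities.
width-append : ∀ t y x → width t y +ℤ width (y +ℤ + 1) x ≡ width t x
width-append = identity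
  where
  identity : ∀ t y x → (y -ℤ t +ℤ 1ℤ) +ℤ (x -ℤ (y +ℤ 1ℤ) +ℤ 1ℤ) ≡ x -ℤ t +ℤ 1ℤ
  identity = ℤ-Ring.solve-∀

width-inverseˡ : ∀ t w → width t (w +ℤ (t -ℤ + 1)) ≡ w
width-inverseˡ = identity
  where
  identity : ∀ t w → (w +ℤ (t -ℤ 1ℤ)) -ℤ t +ℤ 1ℤ ≡ w
  identity = ℤ-Ring.solve-∀

width-inverseʳ : ∀ t x → width t x +ℤ (t -ℤ + 1) ≡ x
width-inverseʳ = identity
  where
  identity : ∀ t x → (x -ℤ t +ℤ 1ℤ) +ℤ (t -ℤ 1ℤ) ≡ x
  identity = ℤ-Ring.solve-∀

width-mono-≤ : ∀ t {x y} → x ℤ.≤ y → width t x ℤ.≤ width t y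
width-mono-≤ t x≤y = ℤ.+-monoˡ-≤ (+ 1) (ℤ.+-monoˡ-≤ (ℤ.- t) x≤y)

width-cancel-≤ : ∀ t {x y} → width t x ℤ.≤ width t y → x ℤ.≤ y
width-cancel-≤ t {x} {y} h =
  subst₂ ℤ._≤_ (width-inverseʳ t x) (width-inverseʳ t y) (ℤ.+-monoˡ-≤ (t -ℤ + 1) h)

+≤⇒≡+ : ∀ {m w} → + m ℤ.≤ w → Σ ℕ λ n → w ≡ + n × m ≤ n
+≤⇒≡+ (ℤ.+≤+ m≤n) = _ , refl , m≤n

size-∈ : ∀ {c ts} → c ∈ ts → size c ≤ sizes ts
size-∈ {c} {_ ∷ ts} (here refl) = m≤m+n (size c) (sizes ts)
size-∈ {_} {t ∷ _}  (there c∈ts) = ≤-trans (size-∈ c∈ts) (m≤n+m _ (size t))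

size-≼ : ∀ {u T} → u ≼ T → size u ≤ size T
size-≼ here            = ≤-refl
size-≼ (there u≼c c∈ts) = ≤-trans (size-≼ u≼c) (m≤n⇒m≤1+n (size-∈ c∈ts))

Ordered-≼ : ∀ {u T} → u ≼ T → Ordered T → Ordered u
Ordered-≼ here             ordT         = ordT
Ordered-≼ (there u≼c c∈ts) (ord _ ords) = Ordered-≼ u≼c (All.lookup ords c∈ts)

size-nonZero : ∀ t → NonZero (size t)
size-nonZero (node _) = _

module _ (L : ℕ) .{{_ : NonZero L}} where

  ∃-floor-root : ∀ N → Σ ℕ λ m → m ^ L ≤ N × N < suc m ^ L
  ∃-floor-root zero = 0 , ≤-reflexive (0^n≡0 L) , subst (0 <_) (sym (^-zeroˡ L)) z<s
  ∃-floor-root (suc N) with ∃-floor-root N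
  ... | m , m^L≤N , N<[1+m]^L with suc N <? suc m ^ L
  ...   | yes 1+N<[1+m]^L = m , m≤n⇒m≤1+n m^L≤N , 1+N<[1+m]^L
  ...   | no  1+N≮[1+m]^L = suc m , ≤-reflexive [1+m]^L≡1+N ,
                             subst (_< suc (suc m) ^ L) [1+m]^L≡1+N (^-monoˡ-< L (n<1+n (suc m)))
    where
    [1+m]^L≡1+N : suc m ^ L ≡ suc N
    [1+m]^L≡1+N = ≤-antisym (≮⇒≥ 1+N≮[1+m]^L) N<[1+m]^L

  infix 4 _≤_⟨1+ε⟩^_
  _≤_⟨1+ε⟩^_ : ℕ → ℕ → ℕ → Set
  x ≤ s ⟨1+ε⟩^ j = x ^ L ≤ s ^ L * 2 ^ j

  mediant-^-≤ : ∀ c {x y s t} → x ^ L ≤ s ^ L * c → y ^ L ≤ t ^ L * c →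
                (x + y) ^ L ≤ (s + t) ^ L * c
  mediant-^-≤ c {x} {y} {s} {t} hx hy =
    [ ordered hx hy
    , (λ ys≤xt → subst₂ (λ a b → a ^ L ≤ b ^ L * c) (+-comm y x) (+-comm t s)
                         (ordered hy hx ys≤xt))
    ]′ (≤-total (x * t) (y * s))
    where
    ordered : ∀ {x y s t} → x ^ L ≤ s ^ L * c → y ^ L ≤ t ^ L * c → x * t ≤ y * s →
              (x + y) ^ L ≤ (s + t) ^ L * c
    ordered {x} {y} {s} {zero} hx hy _
      with m^n≡0⇒m≡0 y L (n≤0⇒n≡0 (subst (y ^ L ≤_) (cong (_* c) (0^n≡0 L)) hy))
    ... | refl = subst₂ (λ a b → a ^ L ≤ b ^ L * c) (sym (+-identityʳ x)) (sym (+-identityʳ s)) hx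
    ordered {x} {y} {s} {t@(suc _)} hx hy xt≤ys = *-cancelˡ-≤ (t ^ L) {{m^n≢0 t L}} (begin
      t ^ L * (x + y) ^ L          ≡⟨ *-comm (t ^ L) _ ⟩
      (x + y) ^ L * t ^ L          ≡⟨ ^-distribʳ-* (x + y) t L ⟨
      ((x + y) * t) ^ L            ≤⟨ ^-monoˡ-≤ L [x+y]t≤y[s+t] ⟩
      (y * (s + t)) ^ L            ≡⟨ ^-distribʳ-* y (s + t) L ⟩
      y ^ L * (s + t) ^ L          ≤⟨ *-monoˡ-≤ _ hy ⟩
      t ^ L * c * (s + t) ^ L      ≡⟨ *-assoc (t ^ L) c _ ⟩
      t ^ L * (c * (s + t) ^ L)    ≡⟨ cong (t ^ L *_) (*-comm c _) ⟩
      t ^ L * ((s + t) ^ L * c)    ∎)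
      where
      open ≤-Reasoning
      [x+y]t≤y[s+t] : (x + y) * t ≤ y * (s + t)
      [x+y]t≤y[s+t] = begin
        (x + y) * t    ≡⟨ *-distribʳ-+ t x y ⟩
        x * t + y * t  ≤⟨ +-monoˡ-≤ (y * t) xt≤ys ⟩
        y * s + y * t  ≡⟨ *-distribˡ-+ y s t ⟨
        y * (s + t)    ∎

  ≤⟨1+ε⟩^-+ : ∀ {x y s t j} → x ≤ s ⟨1+ε⟩^ j → y ≤ t ⟨1+ε⟩^ j → x + y ≤ s + t ⟨1+ε⟩^ j
  ≤⟨1+ε⟩^-+ {j = j} = mediant-^-≤ (2 ^ j)

  ≤⟨1+ε⟩^-mono : ∀ {x s s' j j'} → s ≤ s' → j ≤ j' → x ≤ s ⟨1+ε⟩^ j → x ≤ s' ⟨1+ε⟩^ j'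
  ≤⟨1+ε⟩^-mono s≤s' j≤j' x≤ = ≤-trans x≤ (*-mono-≤ (^-monoˡ-≤ L s≤s') (^-monoʳ-≤ 2 j≤j'))

  ≤-≤⟨1+ε⟩^-trans : ∀ {x y s j} → x ≤ y → y ≤ s ⟨1+ε⟩^ j → x ≤ s ⟨1+ε⟩^ j
  ≤-≤⟨1+ε⟩^-trans x≤y y≤ = ≤-trans (^-monoˡ-≤ L x≤y) y≤

  ≤⟨1+ε⟩^-trans : ∀ {x y s i j} → x ≤ y ⟨1+ε⟩^ i → y ≤ s ⟨1+ε⟩^ j → x ≤ s ⟨1+ε⟩^ (j + i)
  ≤⟨1+ε⟩^-trans {x} {y} {s} {i} {j} x≤ y≤ = begin
    x ^ L                    ≤⟨ x≤ ⟩
    y ^ L * 2 ^ i            ≤⟨ *-monoˡ-≤ (2 ^ i) y≤ ⟩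
    s ^ L * 2 ^ j * 2 ^ i    ≡⟨ *-assoc (s ^ L) _ _ ⟩
    s ^ L * (2 ^ j * 2 ^ i)  ≡⟨ cong (s ^ L *_) (^-distribˡ-+-* 2 j i) ⟨
    s ^ L * 2 ^ (j + i)      ∎
    where open ≤-Reasoning

  1≤1⟨1+ε⟩^ : ∀ j → 1 ≤ 1 ⟨1+ε⟩^ j
  1≤1⟨1+ε⟩^ j = subst (λ o → o ≤ o * 2 ^ j) (sym (^-zeroˡ L)) (*-monoʳ-≤ 1 (m^n>0 2 j))

  round-up : ∀ {x} → 1 ≤ x → x ≤ 2 ^ L ⟨1+ε⟩^ L → Σ ℕ λ m → InS L m × x ≤ m × (m ≤ x ⟨1+ε⟩^ 1)
  round-up {x} 1≤x x≤ =
    let m , m^L≤2^k , 2^k<[1+m]^L = ∃-floor-root (2 ^ k)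
    in m , (k , k<4*L*L , m^L≤2^k , 2^k<[1+m]^L) ,
       ≤-pred (^-cancelˡ-< L (≤-<-trans x^L≤2^k 2^k<[1+m]^L)) ,
       ≤-trans m^L≤2^k 2^k≤x^L*2
    where
    k = ⌈log₂ (x ^ L) ⌉
    x^L≤2^k : x ^ L ≤ 2 ^ k
    x^L≤2^k = n≤2^⌈log₂n⌉ (x ^ L)
    2^k≤x^L*2 : 2 ^ k ≤ x ^ L * 2 ^ 1
    2^k≤x^L*2 = subst (2 ^ k ≤_) (*-comm 2 (x ^ L))
                  (2^⌈log₂n⌉≤2*n (x ^ L) {{m^n≢0 x L {{>-nonZero 1≤x}}}})
    [2^L]^L*2^L≡2^[L*L+L] : (2 ^ L) ^ L * 2 ^ L ≡ 2 ^ (L * L + L)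
    [2^L]^L*2^L≡2^[L*L+L] =
      trans (cong (_* 2 ^ L) (^-*-assoc 2 L L)) (sym (^-distribˡ-+-* 2 (L * L) L))
    k<4*L*L : k < 4 * L * L
    k<4*L*L = ≤-<-trans (n≤2^k⇒⌈log₂n⌉≤k (subst (x ^ L ≤_) [2^L]^L*2^L≡2^[L*L+L] x≤))
                        (n*n+n<4*n*n L)

  -- Rounding up into S, whose elements are positive, needs the width to be positive.
  data WidthLeScaled (t x : ℤ) (s j : ℕ) : Set where
    bound : ∀ {m} → width t x ≡ + m → 1 ≤ m → m ≤ s ⟨1+ε⟩^ j → WidthLeScaled t x s j

  WidthLeScaled⇒LeScaled : ∀ {t x s j} → WidthLeScaled t x s j → LeScaled L (width t x) s j
  WidthLeScaled⇒LeScaled (bound {m} w≡m _ m≤) = inj₂ (m , w≡m , m≤)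

  WidthLeScaled-mono : ∀ {t x s s' j j'} → s ≤ s' → j ≤ j' → WidthLeScaled t x s j →
                       WidthLeScaled t x s' j'
  WidthLeScaled-mono s≤s' j≤j' (bound w≡m 1≤m m≤) = bound w≡m 1≤m (≤⟨1+ε⟩^-mono s≤s' j≤j' m≤)

  WidthLeScaled-self : ∀ t j → WidthLeScaled t t 1 j
  WidthLeScaled-self t j = bound (width-self t) ≤-refl (1≤1⟨1+ε⟩^ j)

  WidthLeScaled-append : ∀ {t y x s s' j j'} → j' ≤ j → WidthLeScaled t y s j →
                         WidthLeScaled (y +ℤ + 1) x s' j' → WidthLeScaled t x (s + s') j
  WidthLeScaled-append {t} {y} {x} {s' = s'} {j} j'≤j
                       (bound {m} w≡m 1≤m m≤) (bound {m'} w'≡m' _ m'≤) =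
    bound w≡m+m' (≤-trans 1≤m (m≤m+n m m'))
          (≤⟨1+ε⟩^-+ {j = j} m≤ (≤⟨1+ε⟩^-mono {s = s'} ≤-refl j'≤j m'≤))
    where
    open ≡-Reasoning
    w≡m+m' : width t x ≡ + (m + m')
    w≡m+m' = begin
      width t x                          ≡⟨ width-append t y x ⟨
      width t y +ℤ width (y +ℤ + 1) x    ≡⟨ cong₂ _+ℤ_ w≡m w'≡m' ⟩
      + m +ℤ + m'                        ≡⟨ ℤ.pos-+ m m' ⟨
      + (m + m')                         ∎

  WidthLeScaled-⊔ : ∀ {t x y s j} → WidthLeScaled t x s j → WidthLeScaled t y s j →
                    WidthLeScaled t (x ⊔ y) s j
  WidthLeScaled-⊔ {t} {x} {y} {s} {j} hx hy =
    [ (λ x⊔y≡x → subst P (sym x⊔y≡x) hx) , (λ x⊔y≡y → subst P (sym x⊔y≡y) hy) ]′ (ℤ.⊔-sel x y)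
    where
    P : ℤ → Set
    P z = WidthLeScaled t z s j

  IsLeastB-≤ : ∀ {t ā b X m} → IsLeastB L t ā b → width t ā ≡ + X → InS L m → X ≤ m →
               width t b ℤ.≤ + m
  IsLeastB-≤ {t} {ā} {b} {X} {m} (_ , _ , least) w≡X m∈S X≤m =
    subst (width t b ℤ.≤_) (width-inverseˡ t (+ m))
      (width-mono-≤ t (least c ā≤c (m , width-inverseˡ t (+ m) , m∈S)))
    where
    c = + m +ℤ (t -ℤ + 1)
    ā≤c : ā ℤ.≤ c
    ā≤c = width-cancel-≤ t (subst₂ ℤ._≤_ (sym w≡X) (sym (width-inverseˡ t (+ m))) (ℤ.+≤+ X≤m))

  IsLeastB-bound : ∀ {t ā b s j} → s ≤ 2 ^ L → j ≤ L → IsLeastB L t ā b →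
                   WidthLeScaled t ā s j → WidthLeScaled t b s (j + 1)
  IsLeastB-bound {t} {s = s} {j} s≤2^L j≤L isLeast@(ā≤b , _) (bound {X} w≡X 1≤X X≤) =
    let m , m∈S , X≤m , m≤ = round-up 1≤X (≤⟨1+ε⟩^-mono s≤2^L j≤L X≤)
        B , w≡B , X≤B = +≤⇒≡+ (subst (ℤ._≤ _) w≡X (width-mono-≤ t ā≤b))
        B≤m = ℤ.drop‿+≤+ (subst (ℤ._≤ + m) w≡B (IsLeastB-≤ isLeast w≡X m∈S X≤m))
    in bound w≡B (≤-trans 1≤X X≤B)
         (≤-≤⟨1+ε⟩^-trans {s = s} {j + 1} B≤m (≤⟨1+ε⟩^-trans {i = 1} {j} m≤ X≤))

  run-bounds : ∀ {u t r} → Run L u t r → Ordered u → size u ≤ 2 ^ L →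
               WidthLeScaled t (abar r) (size u) ⌊log₂ size u ⌋ ×
               WidthLeScaled t (bbar r) (size u) (⌊log₂ size u ⌋ + 1)
  kids-bounds : ∀ {cs ā b̄ ā' b̄' t s₀ s} → RunKids L cs ā b̄ ā' b̄' → All Ordered cs →
                Linked (λ x y → size x ≤ size y) cs → s₀ + sizes cs ≤ s → s ≤ 2 ^ L →
                WidthLeScaled t ā s₀ ⌊log₂ s ⌋ → WidthLeScaled t b̄ s₀ ⌊log₂ s ⌋ →
                WidthLeScaled t ā' s ⌊log₂ s ⌋ × WidthLeScaled t b̄' s (⌊log₂ s ⌋ + 1)

  run-bounds {t = t} (run {ts} runs isLeast) (ord sorted ords) s≤2^L =
    let hā , hb̄ = kids-bounds runs ords sorted ≤-refl s≤2^L
                               (WidthLeScaled-self t _) (WidthLeScaled-self t _)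
    in hā , WidthLeScaled-⊔ (IsLeastB-bound s≤2^L (n≤2^k⇒⌊log₂n⌋≤k s≤2^L) isLeast hā) hb̄

  kids-bounds done _ _ s₀+0≤s _ hā hb̄ =
    WidthLeScaled-mono s₀≤s ≤-refl hā , WidthLeScaled-mono s₀≤s (m≤m+n _ 1) hb̄
    where
    s₀≤s = ≤-trans (m≤m+n _ 0) s₀+0≤s
  kids-bounds {s₀ = s₀} {s} (step {c} run-c done) (ord-c ∷ _) _ s₀+c+0≤s s≤2^L _ hb̄ =
    let hā-c , hb̄-c = run-bounds run-c ord-c (≤-trans c≤s s≤2^L)
    in WidthLeScaled-mono s₀+c≤s ≤-refl (WidthLeScaled-append ⌊c⌋≤⌊s⌋ hb̄ hā-c) ,
       WidthLeScaled-mono s₀+c≤s ≤-refl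
         (WidthLeScaled-append (+-monoˡ-≤ 1 ⌊c⌋≤⌊s⌋)
                               (WidthLeScaled-mono ≤-refl (m≤m+n _ 1) hb̄) hb̄-c)
    where
    s₀+c≤s : s₀ + size c ≤ s
    s₀+c≤s = subst (λ n → s₀ + n ≤ s) (+-identityʳ (size c)) s₀+c+0≤s
    c≤s : size c ≤ s
    c≤s = ≤-trans (m≤n+m (size c) s₀) s₀+c≤s
    ⌊c⌋≤⌊s⌋ : ⌊log₂ size c ⌋ ≤ ⌊log₂ s ⌋
    ⌊c⌋≤⌊s⌋ = ⌊log₂⌋-mono-≤ c≤s
  kids-bounds {s₀ = s₀} {s} (step {c} run-c runs@(step {c'} {cs} _ _))
              (ord-c ∷ ords) (c≤c' ∷ sorted) s₀+cs≤s s≤2^L _ hb̄ =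
    let hā-c , hb̄-c = run-bounds run-c ord-c (≤-trans c≤s s≤2^L)
    in kids-bounds runs ords sorted (≤-trans (≤-reflexive (+-assoc s₀ (size c) _)) s₀+cs≤s) s≤2^L
         (WidthLeScaled-append (⌊log₂⌋-mono-≤ c≤s) hb̄ hā-c)
         (WidthLeScaled-append (2*m≤n⇒⌊log₂m⌋+1≤⌊log₂n⌋ {{size-nonZero c}} 2c≤s) hb̄ hb̄-c)
    where
    2c≤s : 2 * size c ≤ s
    2c≤s = begin
      size c + (size c + 0)                ≡⟨ cong (_+_ (size c)) (+-identityʳ (size c)) ⟩
      size c + size c                      ≤⟨ +-monoʳ-≤ (size c) (≤-trans c≤c' (m≤m+n _ (sizes cs))) ⟩
      size c + (size c' + sizes cs)        ≤⟨ m≤n+m _ s₀ ⟩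
      s₀ + (size c + (size c' + sizes cs)) ≤⟨ s₀+cs≤s ⟩
      s                                    ∎
      where open ≤-Reasoning
    c≤s : size c ≤ s
    c≤s = ≤-trans (m≤n*m (size c) 2) 2c≤s

lemma7 : (n : ℕ) → 2 ≤ n → (T : Tree) → size T ≡ n → Ordered T →
         (u : Tree) → u ≼ T → (t : ℤ) → (r : Vals) → Run ⌈log₂ n ⌉ u t r →
         LeScaled ⌈log₂ n ⌉ (abar r -ℤ a r +ℤ + 1) (size u) ⌊log₂ size u ⌋
         × LeScaled ⌈log₂ n ⌉ (bbar r -ℤ a r +ℤ + 1) (size u) (⌊log₂ size u ⌋ + 1)
lemma7 n 2≤n T refl ordT u u≼T t r run-u@(run _ _) =
  let L = ⌈log₂ n ⌉
      instance L≢0 : NonZero L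
               L≢0 = >-nonZero (⌈log₂⌉-mono-≤ 2≤n)
      hā , hb̄ = run-bounds L run-u (Ordered-≼ u≼T ordT) (≤-trans (size-≼ u≼T) (n≤2^⌈log₂n⌉ n))
  in WidthLeScaled⇒LeScaled L hā , WidthLeScaled⇒LeScaled L hb̄
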